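{- Let $u$, $d$, $s$ and $m$ be positive integers with $s>1$ and $s$ coprime to $md$. Let $v=u+d$, and suppose $s\geq m v(u-1)$. Then, for every element $(x,y)$ of the group $\mathbb{T}=\mathbb{Z}_{s+md}\times\mathbb{Z}_s$, there exist nonnegative integers $h<s+mv$ and $\ell<s-m(u-1)$ such that $(x,y)=h(1,1)+\ell(u,v)$ in $\mathbb{T}$.
   Context: $\mathbb{Z}_n$ denotes the cyclic group of integers modulo $n$, written additively. -}

module Defs where

open import Data.Nat using (ℕ; _<_; NonZero; >-nonZero)
open import Data.Nat.DivMod using (_mod_)
open import Data.Fin using (Fin)
open import Data.Product using (_×_)

ℤ_ : ℕ → Set
ℤ_ n = Fin n

[_]_ : ℕ → (n : ℕ) → 0 < n → ℤ_ n
[ k ] n = λ 0<n → _mod_ k n {{>-nonZero 0<n}}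

𝕋 : ℕ → ℕ → Set
𝕋 a b = ℤ_ a × ℤ_ b

-- Every (h , ℓ) ∈ ℕ² represents the point h(1,1) + ℓ(u,v) of 𝕋, and by the Chinese remainder
-- theorem (gcd(s + md, s) = gcd(md, s) = 1) every point is represented by some (h₀ , 0).
-- Put c = s − mv(u−1), A = s + mv and B = s − m(u−1). In 𝕋 we have B(u,v) = c(1,1) and
-- A(1,1) = m(u,v), so (h , B + ℓ) may be traded for (c + h , ℓ) and (A + h , ℓ) for (h , m + ℓ)
-- without changing the point represented. Each trade strictly decreases the potential
-- hB + ℓ(c+1), the second one because AB = mc + (s + md)s > m(c+1); so trading terminates,
-- and it can only stop at a pair with h < A and ℓ < B.
module Submission where

open import Defs
open import Data.Nat using (ℕ; zero; suc; _+_; _*_; _∸_; _<_; _≥_; z<s; NonZero; >-nonZero; _<?_)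
open import Data.Nat.Coprimality using (Coprime; coprime-Bézout; coprime-+) renaming (sym to coprime-sym)
open import Data.Nat.GCD using (module Bézout)
open import Data.Nat.DivMod
  using (_%_; _mod_; %-congˡ; %-distribˡ-+; %-distribˡ-*; [m+kn]%n≡m%n; m<n⇒m%n≡m; m%n<n)
open import Data.Nat.Induction using (<-wellFounded)
open import Data.Nat.Properties
  using (<-≤-trans; <-trans; m≤m+n; m≤n+m; m<n+m; m≤m*n; 0<1+n; +-monoˡ-<; +-comm; +-assoc; +-identityʳ;
         *-identityʳ; *-assoc; *-suc; m+n∸m≡n; m+[n∸m]≡n; m≤n⇒∃[o]m+o≡n; ≮⇒≥; module ≤-Reasoning)
open import Data.Nat.Tactic.RingSolver using (solve-∀)
open import Data.Fin using (Fin; toℕ)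
open import Data.Fin.Properties using (toℕ-fromℕ<; toℕ-injective; toℕ<n)
open import Data.Product using (Σ; ∃; ∃₂; _×_; _,_)
open import Induction.WellFounded using (Acc; acc)
open import Relation.Binary.PropositionalEquality
  using (_≡_; refl; sym; trans; cong; subst; module ≡-Reasoning)
open import Relation.Nullary using (yes; no)

m≡n+kd⇒m%d≡n%d : ∀ {m n} k d .{{_ : NonZero d}} → m ≡ n + k * d → m % d ≡ n % d
m≡n+kd⇒m%d≡n%d {n = n} k d m≡n+kd = trans (%-congˡ m≡n+kd) ([m+kn]%n≡m%n n k d)

%≡⇒mod≡ : ∀ k {n} .{{_ : NonZero n}} (x : Fin n) → k % n ≡ toℕ x % n → k mod n ≡ x
%≡⇒mod≡ k x k%n≡x%n =
  toℕ-injective (trans (toℕ-fromℕ< (m%n<n k _)) (trans k%n≡x%n (m<n⇒m%n≡m (toℕ<n x))))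

n%d≡1⇒[m*n]%d≡m%d : ∀ m {n} d .{{_ : NonZero d}} → n % d ≡ 1 % d → (m * n) % d ≡ m % d
n%d≡1⇒[m*n]%d≡m%d m {n} d n%d≡1 = begin
  (m * n) % d                 ≡⟨ %-distribˡ-* m n d ⟩
  ((m % d) * (n % d)) % d     ≡⟨ cong (λ z → ((m % d) * z) % d) n%d≡1 ⟩
  ((m % d) * (1 % d)) % d     ≡⟨ %-distribˡ-* m 1 d ⟨
  (m * 1) % d                 ≡⟨ %-congˡ (*-identityʳ m) ⟩
  m % d                       ∎
  where open ≡-Reasoning

%-trade : ∀ a b w h ℓ {n} .{{_ : NonZero n}} → (a * w) % n ≡ b % n →
          (h + (a + ℓ) * w) % n ≡ (b + h + ℓ * w) % n
%-trade a b w h ℓ {n} aw%n≡b%n = begin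
  (h + (a + ℓ) * w) % n                ≡⟨ %-congˡ (regroup a w h ℓ) ⟩
  (a * w + (h + ℓ * w)) % n            ≡⟨ %-distribˡ-+ (a * w) _ n ⟩
  ((a * w) % n + (h + ℓ * w) % n) % n  ≡⟨ cong (λ z → (z + (h + ℓ * w) % n) % n) aw%n≡b%n ⟩
  (b % n + (h + ℓ * w) % n) % n        ≡⟨ %-distribˡ-+ b _ n ⟨
  (b + (h + ℓ * w)) % n                ≡⟨ %-congˡ (+-assoc b h (ℓ * w)) ⟨
  (b + h + ℓ * w) % n                  ∎
  where
  open ≡-Reasoning
  regroup : ∀ a w h ℓ → h + (a + ℓ) * w ≡ a * w + (h + ℓ * w)
  regroup = solve-∀

modular-inverse : ∀ a b .{{_ : NonZero a}} → Coprime a b → ∃ λ k → (k * b) % a ≡ 1 % a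
modular-inverse a@(suc a′) b coprime with coprime-Bézout coprime
... | Bézout.-+ x y 1+xa≡yb = y , m≡n+kd⇒m%d≡n%d x a (sym 1+xa≡yb)
-- y·b ≡ −1 (mod a), hence (a − 1)·y·b ≡ 1
... | Bézout.+- x y 1+yb≡xa = a′ * y , (begin
  (a′ * y * b) % a          ≡⟨ [m+kn]%n≡m%n (a′ * y * b) 1 a ⟨
  (a′ * y * b + 1 * a) % a  ≡⟨ %-congˡ a′yb+a≡1+a′xa ⟩
  (1 + a′ * x * a) % a      ≡⟨ [m+kn]%n≡m%n 1 (a′ * x) a ⟩
  1 % a                     ∎)
  where
  open ≡-Reasoning
  a′yb+a≡1+a′xa : a′ * y * b + 1 * a ≡ 1 + a′ * x * a
  a′yb+a≡1+a′xa = begin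
    a′ * y * b + 1 * a     ≡⟨ expand a′ y b ⟩
    1 + a′ * (1 + y * b)   ≡⟨ cong (λ z → 1 + a′ * z) 1+yb≡xa ⟩
    1 + a′ * (x * a)       ≡⟨ cong (1 +_) (*-assoc a′ x a) ⟨
    1 + a′ * x * a         ∎
    where
    expand : ∀ a′ y b → a′ * y * b + 1 * suc a′ ≡ 1 + a′ * (1 + y * b)
    expand = solve-∀

chinese-remainder : ∀ a b .{{_ : NonZero a}} .{{_ : NonZero b}} → Coprime a b →
                    ∀ x y → ∃ λ h → h % a ≡ x % a × h % b ≡ y % b
chinese-remainder a b coprime x y
  with modular-inverse a b coprime | modular-inverse b a (coprime-sym coprime)
... | k , kb%a≡1 | k′ , k′a%b≡1 =
  x * (k * b) + y * (k′ * a) ,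
  residue x y k b k′ kb%a≡1 ,
  trans (%-congˡ (+-comm (x * (k * b)) _)) (residue y x k′ a k k′a%b≡1)
  where
  residue : ∀ {p} .{{_ : NonZero p}} x y r q r′ → (r * q) % p ≡ 1 % p →
            (x * (r * q) + y * (r′ * p)) % p ≡ x % p
  residue {p} x y r q r′ rq%p≡1 = begin
    (x * (r * q) + y * (r′ * p)) % p  ≡⟨ %-congˡ (cong (x * (r * q) +_) (*-assoc y r′ p)) ⟨
    (x * (r * q) + y * r′ * p) % p    ≡⟨ [m+kn]%n≡m%n (x * (r * q)) (y * r′) p ⟩
    (x * (r * q)) % p                 ≡⟨ n%d≡1⇒[m*n]%d≡m%d x p rq%p≡1 ⟩
    x % p                             ∎
    where open ≡-Reasoning

module Descent (A B c m : ℕ) (Inv : ℕ → ℕ → Set) (0<B : 0 < B) (m*[1+c]<A*B : m * suc c < A * B)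
               (trade-ℓ : ∀ {h ℓ} → Inv h (B + ℓ) → Inv (c + h) ℓ)
               (trade-h : ∀ {h ℓ} → Inv (A + h) ℓ → Inv h (m + ℓ)) where

  potential : ℕ → ℕ → ℕ
  potential h ℓ = h * B + ℓ * suc c

  potential-trade-ℓ : ∀ h ℓ → potential (c + h) ℓ < potential h (B + ℓ)
  potential-trade-ℓ h ℓ = subst (potential (c + h) ℓ <_) (sym (expand B c h ℓ)) (m<n+m _ 0<B)
    where
    expand : ∀ B c h ℓ → h * B + (B + ℓ) * suc c ≡ B + ((c + h) * B + ℓ * suc c)
    expand = solve-∀

  potential-trade-h : ∀ h ℓ → potential h (m + ℓ) < potential (A + h) ℓ
  potential-trade-h h ℓ = begin-strict
    h * B + (m + ℓ) * suc c          ≡⟨ expandˡ m c h B ℓ ⟩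
    m * suc c + potential h ℓ        <⟨ +-monoˡ-< (potential h ℓ) m*[1+c]<A*B ⟩
    A * B + potential h ℓ            ≡⟨ expandʳ A B h ℓ c ⟩
    (A + h) * B + ℓ * suc c          ∎
    where
    open ≤-Reasoning
    expandˡ : ∀ m c h B ℓ → h * B + (m + ℓ) * suc c ≡ m * suc c + (h * B + ℓ * suc c)
    expandˡ = solve-∀
    expandʳ : ∀ A B h ℓ c → A * B + (h * B + ℓ * suc c) ≡ (A + h) * B + ℓ * suc c
    expandʳ = solve-∀

  reduce : ∀ h ℓ → Acc _<_ (potential h ℓ) → Inv h ℓ →
           ∃₂ λ h′ ℓ′ → h′ < A × ℓ′ < B × Inv h′ ℓ′
  reduce h ℓ (acc smaller) inv with ℓ <? B | h <? A
  ... | yes ℓ<B | yes h<A = h , ℓ , h<A , ℓ<B , inv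
  ... | no ℓ≮B | _ with m≤n⇒∃[o]m+o≡n (≮⇒≥ ℓ≮B)
  ...   | ℓ′ , refl = reduce (c + h) ℓ′ (smaller (potential-trade-ℓ h ℓ′)) (trade-ℓ inv)
  reduce h ℓ (acc smaller) inv | yes _ | no h≮A with m≤n⇒∃[o]m+o≡n (≮⇒≥ h≮A)
  ...   | h′ , refl = reduce h′ (m + ℓ) (smaller (potential-trade-h h′ ℓ)) (trade-h inv)

  normal-form : ∀ {h ℓ} → Inv h ℓ → ∃₂ λ h′ ℓ′ → h′ < A × ℓ′ < B × Inv h′ ℓ′
  normal-form {h} {ℓ} = reduce h ℓ (<-wellFounded (potential h ℓ))

module Representation (u′ d m c : ℕ) where

  u v s N A B : ℕ
  u = suc u′
  v = u + d
  s = m * v * u′ + c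
  N = s + m * d
  A = s + m * v
  B = c + m * u′ * (u′ + d)   -- s − m(u − 1), without truncated subtraction

  B*u≡c+u′*N : B * u ≡ c + u′ * N
  B*u≡c+u′*N = identity u′ d m c
    where
    identity : ∀ u′ d m c →
               (c + m * u′ * (u′ + d)) * suc u′ ≡ c + u′ * (m * (suc u′ + d) * u′ + c + m * d)
    identity = solve-∀

  B*v≡c+[u′+d]*s : B * v ≡ c + (u′ + d) * s
  B*v≡c+[u′+d]*s = identity u′ d m c
    where
    identity : ∀ u′ d m c →
               (c + m * u′ * (u′ + d)) * (suc u′ + d) ≡ c + (u′ + d) * (m * (suc u′ + d) * u′ + c)
    identity = solve-∀

  A≡m*u+N : A ≡ m * u + 1 * N
  A≡m*u+N = identity s m u d
    where
    identity : ∀ s m u d → s + m * (u + d) ≡ m * u + 1 * (s + m * d)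
    identity = solve-∀

  A≡m*v+s : A ≡ m * v + 1 * s
  A≡m*v+s = identity s (m * v)
    where
    identity : ∀ s mv → s + mv ≡ mv + 1 * s
    identity = solve-∀

  A*B≡m*c+N*s : A * B ≡ m * c + N * s
  A*B≡m*c+N*s = identity u′ d m c
    where
    identity : ∀ u′ d m c →
               (m * (suc u′ + d) * u′ + c + m * (suc u′ + d)) * (c + m * u′ * (u′ + d))
               ≡ m * c + (m * (suc u′ + d) * u′ + c + m * d) * (m * (suc u′ + d) * u′ + c)
    identity = solve-∀

  s∸m*u′≡B : s ∸ m * u′ ≡ B
  s∸m*u′≡B = trans (cong (_∸ m * u′) (identity u′ d m c)) (m+n∸m≡n (m * u′) B)
    where
    identity : ∀ u′ d m c → m * (suc u′ + d) * u′ + c ≡ m * u′ + (c + m * u′ * (u′ + d))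
    identity = solve-∀

  0<B : 0 < m → 0 < s → 0 < B
  0<B = positive u′ m
    where
    positive : ∀ u′ m → 0 < m → 0 < m * (suc u′ + d) * u′ + c → 0 < c + m * u′ * (u′ + d)
    positive zero     m        _ 0<s = subst (0 <_) (identity m d c) 0<s
      where
      identity : ∀ m d c → m * suc d * 0 + c ≡ c + m * 0 * d
      identity = solve-∀
    positive (suc _)  (suc _)  _ _ = <-≤-trans z<s (m≤n+m _ c)

  module _ (0<s : 0 < s) where

    instance
      s-nonZero : NonZero s
      s-nonZero = >-nonZero 0<s
      N-nonZero : NonZero N
      N-nonZero = >-nonZero (<-≤-trans 0<s (m≤m+n s (m * d)))

    m*[1+c]<A*B : 0 < d → m * suc c < A * B
    m*[1+c]<A*B 0<d = begin-strict
      m * suc c      ≡⟨ *-suc m c ⟩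
      m + m * c      <⟨ +-monoˡ-< (m * c) m<N*s ⟩
      N * s + m * c  ≡⟨ +-comm (N * s) (m * c) ⟩
      m * c + N * s  ≡⟨ A*B≡m*c+N*s ⟨
      A * B          ∎
      where
      open ≤-Reasoning
      m<N*s : m < N * s
      m<N*s = begin-strict
        m      ≤⟨ m≤m*n m d {{>-nonZero 0<d}} ⟩
        m * d  <⟨ m<n+m (m * d) 0<s ⟩
        N      ≤⟨ m≤m*n N s ⟩
        N * s  ∎

    Represents : ℕ → ℕ → ℕ → ℕ → Set
    Represents X Y h ℓ = (h + ℓ * u) % N ≡ X % N × (h + ℓ * v) % s ≡ Y % s

    trade-ℓ : ∀ {X Y h ℓ} → Represents X Y h (B + ℓ) → Represents X Y (c + h) ℓ
    trade-ℓ {h = h} {ℓ} (≡X , ≡Y) =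
      trans (sym (%-trade B c u h ℓ (m≡n+kd⇒m%d≡n%d u′ N B*u≡c+u′*N))) ≡X ,
      trans (sym (%-trade B c v h ℓ (m≡n+kd⇒m%d≡n%d (u′ + d) s B*v≡c+[u′+d]*s))) ≡Y

    trade-h : ∀ {X Y h ℓ} → Represents X Y (A + h) ℓ → Represents X Y h (m + ℓ)
    trade-h {h = h} {ℓ} (≡X , ≡Y) =
      trans (%-trade m A u h ℓ (sym (m≡n+kd⇒m%d≡n%d 1 N A≡m*u+N))) ≡X ,
      trans (%-trade m A v h ℓ (sym (m≡n+kd⇒m%d≡n%d 1 s A≡m*v+s))) ≡Y

    represented-with-ℓ≡0 : Coprime s (m * d) → ∀ X Y → ∃ λ h → Represents X Y h 0
    represented-with-ℓ≡0 coprime X Y with chinese-remainder N s (coprime-+ (coprime-sym coprime)) X Y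
    ... | h , h%N≡X , h%s≡Y =
      h , trans (%-congˡ (+-identityʳ h)) h%N≡X , trans (%-congˡ (+-identityʳ h)) h%s≡Y

    representable : 0 < m → 0 < d → Coprime s (m * d) →
                    ∀ X Y → ∃₂ λ h ℓ → h < A × ℓ < B × Represents X Y h ℓ
    representable 0<m 0<d coprime X Y with represented-with-ℓ≡0 coprime X Y
    ... | h₀ , represents = normal-form {h₀} {0} represents
      where
      open Descent A B c m (Represents X Y) (0<B 0<m 0<s) (m*[1+c]<A*B 0<d) trade-ℓ trade-h

lemma5 : (u d s m : ℕ) → 0 < u → 0 < d → (1<s : 1 < s) → 0 < m →
    Coprime s (m * d) →
    s ≥ m * (u + d) * (u ∸ 1) →
    (x : ℤ_ (s + m * d)) → (y : ℤ_ s) →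
    Σ ℕ λ h → Σ ℕ λ ℓ →
      h < s + m * (u + d) × ℓ < s ∸ m * (u ∸ 1) ×
      ([ h + ℓ * u ] (s + m * d)) (<-≤-trans (<-trans 0<1+n 1<s) (m≤m+n s (m * d))) ≡ x ×
      ([ h + ℓ * (u + d) ] s) (<-trans 0<1+n 1<s) ≡ y
lemma5 (suc u′) d s m _ 0<d 1<s 0<m coprime s≥mvu′ x y
  with s ∸ m * (suc u′ + d) * u′ | m+[n∸m]≡n s≥mvu′
... | c | refl =
  let open Representation u′ d m c
      0<s = <-trans z<s 1<s
      h , ℓ , h<A , ℓ<B , h+ℓu≡x , h+ℓv≡y = representable 0<s 0<m 0<d coprime (toℕ x) (toℕ y)
  in h , ℓ , h<A , subst (ℓ <_) (sym s∸m*u′≡B) ℓ<B ,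
     %≡⇒mod≡ _ {{N-nonZero 0<s}} x h+ℓu≡x , %≡⇒mod≡ _ {{s-nonZero 0<s}} y h+ℓv≡y
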